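{- For every fixed integer $k\ge 1$, the largest order $\theta(k)$ of a maximal outerplanar graph $G$ with boundary cycle $\mathcal{C}$ such that $n_G(ab)\le k$ for all $ab\in E(\mathcal{C})$ is \[ \theta(k)=3\cdot 2^k. \]
   Context: A maximal outerplanar graph of order $n$ is regarded as a drawing consisting of an $n$-cycle $\mathcal{C}$ together with a triangulation (by non-crossing edges between vertices of $\mathcal{C}$) of the bounded region determined by $\mathcal{C}$. Edges not in $\mathcal{C}$ are chords; the length of a chord is the length of a shortest path in $\mathcal{C}$ between its endpoints. A diameter is a chord of length $n/2$. For an edge $ab\in E(\mathcal{C})$: if $G$ has no diameter, $n_G(ab)$ is the number of chords of $G$ whose length is computed along a (shortest) path in $\mathcal{C}$ that includes $ab$; if $G$ has a diameter, $n_G(ab)$ is $\tfrac12$ plus the number of chords of $G$ other than the diameter whose length is computed along a path in $\mathcal{C}$ that includes $ab$. -}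

module Defs where

open import Data.Nat using (ℕ; zero; suc; _+_; _*_; _∸_; _^_; _≤_; _<_; _≤ᵇ_; _<ᵇ_; _≡ᵇ_)
open import Data.Bool using (Bool; true; false; if_then_else_; _∧_; not)
open import Data.List using (List; map)
open import Data.Nat.ListAction using (sum)
open import Data.List.Relation.Unary.All using (All)
open import Data.List.Relation.Unary.Any using (Any)
open import Data.List.Relation.Unary.AllPairs using (AllPairs)
open import Data.List.Relation.Unary.Unique.Propositional using (Unique)
open import Data.List.Membership.Propositional using (_∉_)
open import Data.Product using (_×_; _,_)
open import Data.Sum using (_⊎_)
open import Relation.Nullary using (¬_)
open import Relation.Binary.PropositionalEquality using (_≡_)

-- Vertices of the boundary n-cycle C are 0,1,…,n-1 (in cyclic order);
-- the cycle edges are e_t = {t, t+1 mod n} for t < n.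
-- A chord is represented as a pair (i , j) with i < j < n that is not an edge of C.
IsChord : ℕ → ℕ × ℕ → Set
IsChord n (i , j) = (i < j) × (j < n) × (2 ≤ j ∸ i) × ¬ ((i ≡ 0) × (suc j ≡ n))

Cross : ℕ × ℕ → ℕ × ℕ → Set
Cross (a , b) (c , d) = ((a < c) × (c < b) × (b < d)) ⊎ ((c < a) × (a < d) × (d < b))

-- A maximal outerplanar graph of order n: the n-cycle together with a
-- triangulation of its interior, i.e. a (duplicate-free) set of pairwise
-- non-crossing chords to which no further chord can be added without crossing.
record MOP (n : ℕ) : Set where
  field
    chords   : List (ℕ × ℕ)
    valid    : All (IsChord n) chords
    unique   : Unique chords
    noncross : AllPairs (λ c d → ¬ Cross c d) chords
    maximal  : ∀ c → IsChord n c → c ∉ chords → Any (Cross c) chords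
open MOP public

-- Contribution, in HALF-units, of the chord (i , j) to n_G(e_t):
--  * the path of C from i to j through i,i+1,…,j uses exactly the edges e_t with i ≤ t < j
--    (length j-i); the other path uses the remaining edges (length n-(j-i));
--  * a non-diameter chord contributes 2 (= one chord) to e_t iff e_t lies on its
--    unique shortest path;
--  * a diameter (2(j-i) = n) contributes 1 (= 1/2) to every edge.
weight : ℕ → ℕ → ℕ × ℕ → ℕ
weight n t (i , j) =
  if 2 * (j ∸ i) ≡ᵇ n then 1
  else if 2 * (j ∸ i) <ᵇ n then (if (i ≤ᵇ t) ∧ (t <ᵇ j) then 2 else 0)
  else (if (i ≤ᵇ t) ∧ (t <ᵇ j) then 0 else 2)

nG2 : ∀ {n} → MOP n → ℕ → ℕ
nG2 {n} G t = sum (map (weight n t) (chords G))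

Bounded : ∀ {n} → MOP n → ℕ → Set
Bounded {n} G k = ∀ t → t < n → nG2 G t ≤ 2 * k

-- Summing n_G over the edges of C counts every chord with its length (a diameter gives 1/2 to
-- each of the n edges), so n_G ≤ k on every edge bounds the total chord length by k·n.
-- Conversely, splitting at apexes shows that a chord of length L cuts off a polygon whose chords,
-- itself included, have total length at least (e+1)·L − 2^e for every e.  The triangle of G
-- containing the centre has sides a + b + c = n, each at most n/2, so the total chord length is
-- at least (k+1)·n − 3·2^k, which exceeds k·n once n > 3·2^k.  For n = 3·2^k, three complete
-- binary triangulations of 2^k-gons around the triangle (0, 2^k, 2^(k+1)) attain n_G ≤ k.

{-# OPTIONS --safe #-}
module Submission where

open import Defs
open import Data.Bool using (T; if_then_else_; _∧_; true; false)
open import Data.Empty using (⊥; ⊥-elim)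
open import Data.List using (List; []; _∷_; _++_; map)
open import Data.List.Membership.Propositional using (_∈_; _∉_; find; lose)
open import Data.List.Properties using (map-++)
open import Data.List.Relation.Unary.All as All using (All; []; _∷_)
open import Data.List.Relation.Unary.All.Properties using () renaming (++⁺ to All-++⁺)
open import Data.List.Relation.Unary.AllPairs using (AllPairs; []; _∷_)
open import Data.List.Relation.Unary.AllPairs.Properties using () renaming (++⁺ to AllPairs-++⁺)
open import Data.List.Relation.Unary.Any using (Any; here; there)
open import Data.List.Relation.Unary.Any.Properties using (++⁺ˡ; ++⁺ʳ)
open import Data.Nat using (ℕ; zero; suc; _+_; _*_; _∸_; _^_; _⊓_; _≤_; _<_; _≤ᵇ_; _<ᵇ_; z≤n; s≤s; s≤s⁻¹; z<s; _≤?_; _<?_; _≟_)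
open import Data.Nat.Induction using (<-wellFounded)
open import Data.Nat.ListAction using (sum)
open import Data.Nat.ListAction.Properties using (sum-++)
open import Data.Nat.Properties
open import Algebra.Properties.CommutativeSemigroup +-commutativeSemigroup using () renaming (interchange to +-interchange)
open import Data.Nat.Tactic.RingSolver using (solve-∀)
open import Data.Product using (Σ; ∃-syntax; _×_; _,_; proj₁; proj₂)
open import Data.Product.Properties using (≡-dec)
open import Data.Sum as Sum using (_⊎_; inj₁; inj₂)
open import Data.Unit using (tt)
open import Function using (_∘_)
open import Induction.WellFounded using (Acc; acc)
open import Relation.Binary.Definitions using (tri<; tri≈; tri>)
open import Relation.Binary.PropositionalEquality
open import Relation.Nullary using (¬_; Dec; yes; no)
open import Relation.Nullary.Decidable using (_×-dec_; _⊎-dec_)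
open import Relation.Unary using (Decidable)

a+[b∸a+[n∸b]]≡n : ∀ {a b n} → a ≤ b → b ≤ n → a + (b ∸ a + (n ∸ b)) ≡ n
a+[b∸a+[n∸b]]≡n {a} {b} {n} a≤b b≤n =
  trans (sym (+-assoc a _ _)) (trans (cong (_+ (n ∸ b)) (m+[n∸m]≡n a≤b)) (m+[n∸m]≡n b≤n))

n∸a≡b+[n∸[a+b]] : ∀ a b {n} → a + b ≤ n → n ∸ a ≡ b + (n ∸ (a + b))
n∸a≡b+[n∸[a+b]] a b {n} a+b≤n = begin
  n ∸ a                       ≡⟨ cong (_∸ a) (sym (m+[n∸m]≡n a+b≤n)) ⟩
  a + b + (n ∸ (a + b)) ∸ a   ≡⟨ cong (_∸ a) (+-assoc a b _) ⟩
  a + (b + (n ∸ (a + b))) ∸ a ≡⟨ m+n∸m≡n a _ ⟩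
  b + (n ∸ (a + b))           ∎
  where open ≡-Reasoning

[m∸i]+[j∸m]≡j∸i : ∀ {i m j} → i ≤ m → m ≤ j → (m ∸ i) + (j ∸ m) ≡ j ∸ i
[m∸i]+[j∸m]≡j∸i {i} {m} {j} i≤m m≤j = begin
  (m ∸ i) + (j ∸ m)   ≡⟨ +-comm (m ∸ i) (j ∸ m) ⟩
  (j ∸ m) + (m ∸ i)   ≡⟨ +-∸-assoc (j ∸ m) i≤m ⟨
  (j ∸ m) + m ∸ i     ≡⟨ cong (_∸ i) (m∸n+n≡m m≤j) ⟩
  j ∸ i               ∎
  where open ≡-Reasoning

m∸n≡m∸2n+n : ∀ {m n} → 2 * n ≤ m → m ∸ n ≡ m ∸ 2 * n + n
m∸n≡m∸2n+n {m} {n} 2n≤m = begin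
  m ∸ n                       ≡⟨ cong (_∸ n) (m∸n+n≡m 2n≤m) ⟨
  m ∸ 2 * n + 2 * n ∸ n       ≡⟨ +-∸-assoc (m ∸ 2 * n) (m≤m+n n (n + 0)) ⟩
  m ∸ 2 * n + (2 * n ∸ n)     ≡⟨ cong (m ∸ 2 * n +_) (trans (m+n∸m≡n n (n + 0)) (+-identityʳ n)) ⟩
  m ∸ 2 * n + n               ∎
  where open ≡-Reasoning

n<2^n : ∀ n → n < 2 ^ n
n<2^n zero    = s≤s z≤n
n<2^n (suc n) = +-mono-≤ (≤-trans (s≤s z≤n) (n<2^n n)) (≤-trans (n<2^n n) (m≤m+n (2 ^ n) 0))

sumFrom : (ℕ → ℕ) → ℕ → ℕ → ℕ
sumFrom f a zero    = 0
sumFrom f a (suc m) = f a + sumFrom f (suc a) m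

sumFrom-+ : ∀ f a m m′ → sumFrom f a (m + m′) ≡ sumFrom f a m + sumFrom f (a + m) m′
sumFrom-+ f a zero    m′ rewrite +-identityʳ a = refl
sumFrom-+ f a (suc m) m′ rewrite sumFrom-+ f (suc a) m m′ | +-suc a m = sym (+-assoc (f a) _ _)

sumFrom-cong : ∀ {f g} a m → (∀ {t} → a ≤ t → t < a + m → f t ≡ g t) → sumFrom f a m ≡ sumFrom g a m
sumFrom-cong a zero    eq = refl
sumFrom-cong a (suc m) eq =
  cong₂ _+_ (eq ≤-refl (m<m+n a z<s))
            (sumFrom-cong (suc a) m (λ {t} a<t t<a+m → eq (<⇒≤ a<t) (subst (t <_) (sym (+-suc a m)) t<a+m)))

sumFrom-mono-≤ : ∀ {f g} a m → (∀ {t} → a ≤ t → t < a + m → f t ≤ g t) → sumFrom f a m ≤ sumFrom g a m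
sumFrom-mono-≤ a zero    le = z≤n
sumFrom-mono-≤ a (suc m) le =
  +-mono-≤ (le ≤-refl (m<m+n a z<s))
           (sumFrom-mono-≤ (suc a) m (λ {t} a<t t<a+m → le (<⇒≤ a<t) (subst (t <_) (sym (+-suc a m)) t<a+m)))

sumFrom-const : ∀ v a m → sumFrom (λ _ → v) a m ≡ m * v
sumFrom-const v a zero    = refl
sumFrom-const v a (suc m) = cong (v +_) (sumFrom-const v (suc a) m)

sumFrom-const-on : ∀ f v a m → (∀ {t} → a ≤ t → t < a + m → f t ≡ v) → sumFrom f a m ≡ m * v
sumFrom-const-on f v a m eq = trans (sumFrom-cong a m eq) (sumFrom-const v a m)

sumFrom-distrib-+ : ∀ f g a m → sumFrom (λ t → f t + g t) a m ≡ sumFrom f a m + sumFrom g a m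
sumFrom-distrib-+ f g a zero    = refl
sumFrom-distrib-+ f g a (suc m) rewrite sumFrom-distrib-+ f g (suc a) m =
  +-interchange (f a) (g a) (sumFrom f (suc a) m) (sumFrom g (suc a) m)

sumFrom-split₃ : ∀ f {a b n} → a ≤ b → b ≤ n →
  sumFrom f 0 n ≡ sumFrom f 0 a + (sumFrom f a (b ∸ a) + sumFrom f b (n ∸ b))
sumFrom-split₃ f {a} {b} {n} a≤b b≤n = begin
  sumFrom f 0 n
    ≡⟨ cong (sumFrom f 0) (sym (a+[b∸a+[n∸b]]≡n a≤b b≤n)) ⟩
  sumFrom f 0 (a + (b ∸ a + (n ∸ b)))
    ≡⟨ sumFrom-+ f 0 a _ ⟩
  sumFrom f 0 a + sumFrom f a (b ∸ a + (n ∸ b))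
    ≡⟨ cong (sumFrom f 0 a +_) (sumFrom-+ f a (b ∸ a) (n ∸ b)) ⟩
  sumFrom f 0 a + (sumFrom f a (b ∸ a) + sumFrom f (a + (b ∸ a)) (n ∸ b))
    ≡⟨ cong (λ x → sumFrom f 0 a + (sumFrom f a (b ∸ a) + sumFrom f x (n ∸ b))) (m+[n∸m]≡n a≤b) ⟩
  sumFrom f 0 a + (sumFrom f a (b ∸ a) + sumFrom f b (n ∸ b))   ∎
  where open ≡-Reasoning

sumFrom-two-valued : ∀ f {a b n x y} → a ≤ b → b ≤ n →
  (∀ {t} → t < a ⊎ b ≤ t → f t ≡ x) → (∀ {t} → a ≤ t → t < b → f t ≡ y) →
  sumFrom f 0 n ≡ a * x + ((b ∸ a) * y + (n ∸ b) * x)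
sumFrom-two-valued f {a} {b} {n} {x} {y} a≤b b≤n outside inside = begin
  sumFrom f 0 n                                                ≡⟨ sumFrom-split₃ f a≤b b≤n ⟩
  sumFrom f 0 a + (sumFrom f a (b ∸ a) + sumFrom f b (n ∸ b))
    ≡⟨ cong₂ _+_ (sumFrom-const-on f x 0 a (λ _ t<a → outside (inj₁ t<a)))
                 (cong₂ _+_ (sumFrom-const-on f y a (b ∸ a) (λ a≤t t<a+[b∸a] → inside a≤t (<b t<a+[b∸a])))
                            (sumFrom-const-on f x b (n ∸ b) (λ b≤t _ → outside (inj₂ b≤t)))) ⟩
  a * x + ((b ∸ a) * y + (n ∸ b) * x)                          ∎
  where
  open ≡-Reasoning
  <b : ∀ {t} → t < a + (b ∸ a) → t < b
  <b {t} = subst (t <_) (m+[n∸m]≡n a≤b)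

sum-map-+ : ∀ {A : Set} (f g : A → ℕ) xs → sum (map (λ x → f x + g x) xs) ≡ sum (map f xs) + sum (map g xs)
sum-map-+ f g []       = refl
sum-map-+ f g (x ∷ xs) rewrite sum-map-+ f g xs = +-interchange (f x) (g x) (sum (map f xs)) (sum (map g xs))

sum-map-*ˡ : ∀ {A : Set} (f : A → ℕ) c xs → sum (map (λ x → c * f x) xs) ≡ c * sum (map f xs)
sum-map-*ˡ f c []       = sym (*-zeroʳ c)
sum-map-*ˡ f c (x ∷ xs) = trans (cong (c * f x +_) (sum-map-*ˡ f c xs)) (sym (*-distribˡ-+ c (f x) _))

sum-map-cong : ∀ {A : Set} {f g : A → ℕ} xs → (∀ {x} → x ∈ xs → f x ≡ g x) → sum (map f xs) ≡ sum (map g xs)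
sum-map-cong []       eq = refl
sum-map-cong (x ∷ xs) eq = cong₂ _+_ (eq (here refl)) (sum-map-cong xs (eq ∘ there))

sum-map-mono-≤ : ∀ {A : Set} {f g : A → ℕ} xs → (∀ {x} → x ∈ xs → f x ≤ g x) → sum (map f xs) ≤ sum (map g xs)
sum-map-mono-≤ []       le = z≤n
sum-map-mono-≤ (x ∷ xs) le = +-mono-≤ (le (here refl)) (sum-map-mono-≤ xs (le ∘ there))

≤-sum-map : ∀ {A : Set} (f : A → ℕ) {x xs} → x ∈ xs → f x ≤ sum (map f xs)
≤-sum-map f (here refl)         = m≤m+n _ _
≤-sum-map f {xs = y ∷ _} (there x∈) = ≤-trans (≤-sum-map f x∈) (m≤n+m _ (f y))

sumFrom-sum-comm : ∀ {A : Set} (w : ℕ → A → ℕ) xs a m →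
  sumFrom (λ t → sum (map (w t) xs)) a m ≡ sum (map (λ x → sumFrom (λ t → w t x) a m) xs)
sumFrom-sum-comm w []       a m = trans (sumFrom-const 0 a m) (*-zeroʳ m)
sumFrom-sum-comm w (x ∷ xs) a m =
  trans (sumFrom-distrib-+ (λ t → w t x) (λ t → sum (map (w t) xs)) a m)
        (cong (sumFrom (λ t → w t x) a m +_) (sumFrom-sum-comm w xs a m))

T⇒≡true : ∀ {b} → T b → b ≡ true
T⇒≡true {true} _ = refl

¬T⇒≡false : ∀ {b} → ¬ T b → b ≡ false
¬T⇒≡false {false} _  = refl
¬T⇒≡false {true}  ¬b = ⊥-elim (¬b tt)

inRangeᵇ-true : ∀ {a b t} → a ≤ t → t < b → ((a ≤ᵇ t) ∧ (t <ᵇ b)) ≡ true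
inRangeᵇ-true a≤t t<b rewrite T⇒≡true (≤⇒≤ᵇ a≤t) = T⇒≡true (<⇒<ᵇ t<b)

inRangeᵇ-false : ∀ {a b t} → t < a ⊎ b ≤ t → ((a ≤ᵇ t) ∧ (t <ᵇ b)) ≡ false
inRangeᵇ-false {a} {b} {t} (inj₁ t<a) rewrite ¬T⇒≡false (<⇒≱ t<a ∘ ≤ᵇ⇒≤ a t) = refl
inRangeᵇ-false {a} {b} {t} (inj₂ b≤t) with a ≤ᵇ t
... | false = refl
... | true  = ¬T⇒≡false (≤⇒≯ b≤t ∘ <ᵇ⇒< t b)

weight-diameter : ∀ {n a b} t → 2 * (b ∸ a) ≡ n → weight n t (a , b) ≡ 1
weight-diameter t d rewrite T⇒≡true (≡⇒≡ᵇ _ _ d) = refl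

weight-short : ∀ {n a b} t → 2 * (b ∸ a) < n → weight n t (a , b) ≡ (if (a ≤ᵇ t) ∧ (t <ᵇ b) then 2 else 0)
weight-short t s rewrite ¬T⇒≡false (<⇒≢ s ∘ ≡ᵇ⇒≡ _ _) | T⇒≡true (<⇒<ᵇ s) = refl

weight-long : ∀ {n a b} t → n < 2 * (b ∸ a) → weight n t (a , b) ≡ (if (a ≤ᵇ t) ∧ (t <ᵇ b) then 0 else 2)
weight-long t l rewrite ¬T⇒≡false (>⇒≢ l ∘ ≡ᵇ⇒≡ _ _) | ¬T⇒≡false (<⇒≯ l ∘ <ᵇ⇒< _ _) = refl

weight-short-∈ : ∀ {n a b t} → 2 * (b ∸ a) < n → a ≤ t → t < b → weight n t (a , b) ≡ 2
weight-short-∈ {n} {a} {b} {t} s a≤t t<b rewrite weight-short {n} {a} {b} t s | inRangeᵇ-true a≤t t<b = refl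

weight-short-∉ : ∀ {n a b t} → 2 * (b ∸ a) < n → t < a ⊎ b ≤ t → weight n t (a , b) ≡ 0
weight-short-∉ {n} {a} {b} {t} s t∉ rewrite weight-short {n} {a} {b} t s | inRangeᵇ-false t∉ = refl

weight-long-∈ : ∀ {n a b t} → n < 2 * (b ∸ a) → a ≤ t → t < b → weight n t (a , b) ≡ 0
weight-long-∈ {n} {a} {b} {t} l a≤t t<b rewrite weight-long {n} {a} {b} t l | inRangeᵇ-true a≤t t<b = refl

weight-long-∉ : ∀ {n a b t} → n < 2 * (b ∸ a) → t < a ⊎ b ≤ t → weight n t (a , b) ≡ 2
weight-long-∉ {n} {a} {b} {t} l t∉ rewrite weight-long {n} {a} {b} t l | inRangeᵇ-false t∉ = refl

cyclicLength : ℕ → ℕ → ℕ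
cyclicLength n L = L ⊓ (n ∸ L)

cyclicLength-short : ∀ {n L} → 2 * L ≤ n → cyclicLength n L ≡ L
cyclicLength-short {n} {L} le = m≤n⇒m⊓n≡m (m+n≤o⇒m≤o∸n L (subst (_≤ n) (cong (L +_) (+-identityʳ L)) le))

cyclicLength-long : ∀ {n L} → n < 2 * L → cyclicLength n L ≡ n ∸ L
cyclicLength-long {n} {L} lt = m≥n⇒m⊓n≡n (m≤n+o⇒m∸n≤o n L (subst (n ≤_) (cong (L +_) (+-identityʳ L)) (<⇒≤ lt)))

chordLength : ℕ → ℕ × ℕ → ℕ
chordLength n (a , b) = cyclicLength n (b ∸ a)

sumFrom-weight : ∀ {n a b} → a ≤ b → b ≤ n → sumFrom (λ t → weight n t (a , b)) 0 n ≡ 2 * chordLength n (a , b)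
sumFrom-weight {n} {a} {b} a≤b b≤n with <-cmp (2 * (b ∸ a)) n
... | tri≈ _ d _ = begin
  sumFrom w 0 n                               ≡⟨ sumFrom-const-on w 1 0 n (λ _ _ → weight-diameter {a = a} _ d) ⟩
  n * 1                                       ≡⟨ trans (*-identityʳ n) (sym d) ⟩
  2 * (b ∸ a)                                 ≡⟨ cong (2 *_) (sym (cyclicLength-short {L = b ∸ a} (≤-reflexive d))) ⟩
  2 * chordLength n (a , b)                   ∎
  where open ≡-Reasoning
        w = λ t → weight n t (a , b)
... | tri< s _ _ = begin
  sumFrom w 0 n
    ≡⟨ sumFrom-two-valued w a≤b b≤n (weight-short-∉ {a = a} s) (weight-short-∈ {a = a} s) ⟩
  a * 0 + ((b ∸ a) * 2 + (n ∸ b) * 0)         ≡⟨ count (b ∸ a) a (n ∸ b) ⟩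
  2 * (b ∸ a)                                 ≡⟨ cong (2 *_) (sym (cyclicLength-short {L = b ∸ a} (<⇒≤ s))) ⟩
  2 * chordLength n (a , b)                   ∎
  where open ≡-Reasoning
        w = λ t → weight n t (a , b)
        count : ∀ L a r → a * 0 + (L * 2 + r * 0) ≡ 2 * L
        count = solve-∀
... | tri> _ _ l = begin
  sumFrom w 0 n
    ≡⟨ sumFrom-two-valued w a≤b b≤n (weight-long-∉ {a = a} l) (weight-long-∈ {a = a} l) ⟩
  a * 2 + ((b ∸ a) * 0 + (n ∸ b) * 2)         ≡⟨ count (b ∸ a) a (n ∸ b) ⟩
  2 * (a + (n ∸ b))                           ≡⟨ cong (2 *_) (sym complement) ⟩
  2 * (n ∸ (b ∸ a))                           ≡⟨ cong (2 *_) (sym (cyclicLength-long {L = b ∸ a} l)) ⟩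
  2 * chordLength n (a , b)                   ∎
  where open ≡-Reasoning
        w = λ t → weight n t (a , b)
        count : ∀ L a r → a * 2 + (L * 0 + r * 2) ≡ 2 * (a + r)
        count = solve-∀
        complement : n ∸ (b ∸ a) ≡ a + (n ∸ b)
        complement = trans (n∸a≡b+[n∸[a+b]] (b ∸ a) a (subst (_≤ n) (sym (m∸n+n≡m a≤b)) b≤n))
                           (cong (λ x → a + (n ∸ x)) (m∸n+n≡m a≤b))

-- Lower bounds for triangulated polygons

ShortBound : ℕ → ℕ → Set
ShortBound L w = ∀ e → suc e * L ≤ w + 2 ^ e

-- For a long side with complementary arc c, the triangulation beyond it adds at least e·c − 2^e
-- for every e (by ShortBound), so LongBound K c w guarantees a total of at least K.  Keeping e
-- existential lets it drop by one at each step towards the centre (longBound-join).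
LongBound : ℕ → ℕ → ℕ → Set
LongBound K c w = ∃[ e ] K + 2 ^ e ≤ w + e * c

shortBound-mono : ∀ {L w w′} → w ≤ w′ → ShortBound L w → ShortBound L w′
shortBound-mono w≤w′ B e = ≤-trans (B e) (+-monoˡ-≤ (2 ^ e) w≤w′)

longBound-mono : ∀ {K c w w′} → w ≤ w′ → LongBound K c w → LongBound K c w′
longBound-mono {c = c} w≤w′ (e , B) = e , ≤-trans B (+-monoˡ-≤ (e * c) w≤w′)

shortBound-edge : ∀ w → ShortBound 1 w
shortBound-edge w e = ≤-trans (≤-reflexive (*-identityʳ (suc e))) (≤-trans (n<2^n e) (m≤n+m (2 ^ e) w))

shortBound-join : ∀ {a b wa wb} → ShortBound a wa → ShortBound b wb → ShortBound (a + b) (wa + wb + (a + b))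
shortBound-join {a} {b} {wa} {wb} Ba Bb zero    =
  ≤-trans (≤-reflexive (*-identityˡ (a + b))) (≤-trans (m≤n+m _ (wa + wb)) (m≤m+n _ 1))
shortBound-join {a} {b} {wa} {wb} Ba Bb (suc e) = begin
  suc (suc e) * (a + b)                      ≡⟨ expand (suc e) a b ⟩
  suc e * a + suc e * b + (a + b)            ≤⟨ +-monoˡ-≤ (a + b) (+-mono-≤ (Ba e) (Bb e)) ⟩
  (wa + 2 ^ e) + (wb + 2 ^ e) + (a + b)      ≡⟨ regroup wa wb (a + b) (2 ^ e) ⟩
  wa + wb + (a + b) + 2 ^ suc e              ∎
  where
  open ≤-Reasoning
  expand : ∀ s a b → suc s * (a + b) ≡ s * a + s * b + (a + b)
  expand = solve-∀
  regroup : ∀ x y z p → (x + p) + (y + p) + z ≡ x + y + z + 2 * p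
  regroup = solve-∀

longBound-central : ∀ {K a b c wa wb} e → ShortBound a wa → ShortBound b wb →
  K + 3 * 2 ^ e ≤ suc e * (a + b + c) → LongBound K c (wa + wb + c)
longBound-central {K} {a} {b} {c} {wa} {wb} e Ba Bb K-small = e , +-cancelʳ-≤ (2 ^ e + 2 ^ e) _ _ (begin
  K + 2 ^ e + (2 ^ e + 2 ^ e)                ≡⟨ triple K (2 ^ e) ⟩
  K + 3 * 2 ^ e                              ≤⟨ K-small ⟩
  suc e * (a + b + c)                        ≡⟨ *-distribˡ-+ (suc e) (a + b) c ⟩
  suc e * (a + b) + suc e * c                ≡⟨ cong (_+ suc e * c) (*-distribˡ-+ (suc e) a b) ⟩
  suc e * a + suc e * b + suc e * c          ≤⟨ +-monoˡ-≤ (suc e * c) (+-mono-≤ (Ba e) (Bb e)) ⟩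
  (wa + 2 ^ e) + (wb + 2 ^ e) + suc e * c    ≡⟨ regroup wa wb c e (2 ^ e) ⟩
  wa + wb + c + e * c + (2 ^ e + 2 ^ e)      ∎)
  where
  open ≤-Reasoning
  triple : ∀ K p → K + p + (p + p) ≡ K + 3 * p
  triple = solve-∀
  regroup : ∀ x y c e p → (x + p) + (y + p) + suc e * c ≡ x + y + c + e * c + (p + p)
  regroup = solve-∀

longBound-join : ∀ {K b c wa wb} → LongBound K (b + c) wa → ShortBound b wb → LongBound K c (wa + wb + c)
longBound-join {K} {b} {c} {wa} {wb} (zero , B) Bb = 0 , ≤-trans B (+-monoˡ-≤ 0 (≤-trans (m≤m+n wa wb) (m≤m+n _ c)))
longBound-join {K} {b} {c} {wa} {wb} (suc e , B) Bb = e , +-cancelʳ-≤ (2 ^ e + suc e * b) _ _ (begin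
  K + 2 ^ e + (2 ^ e + suc e * b)            ≡⟨ regroupˡ K (2 ^ e) (suc e * b) ⟩
  K + 2 ^ suc e + suc e * b                  ≤⟨ +-mono-≤ B (Bb e) ⟩
  wa + suc e * (b + c) + (wb + 2 ^ e)        ≡⟨ regroupʳ wa wb b c e (2 ^ e) ⟩
  wa + wb + c + e * c + (2 ^ e + suc e * b)  ∎)
  where
  open ≤-Reasoning
  regroupˡ : ∀ K p q → K + p + (p + q) ≡ K + 2 * p + q
  regroupˡ = solve-∀
  regroupʳ : ∀ x y b c e p → x + suc e * (b + c) + (y + p) ≡ x + y + c + e * c + (p + suc e * b)
  regroupʳ = solve-∀

longBound-edge : ∀ {K w} → LongBound K 1 (w + 1) → K ≤ w
longBound-edge {K} {w} (e , B) = +-cancelʳ-≤ (suc e) K w (begin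
  K + suc e        ≤⟨ +-monoʳ-≤ K (n<2^n e) ⟩
  K + 2 ^ e        ≤⟨ B ⟩
  w + 1 + e * 1    ≡⟨ regroup w e ⟩
  w + suc e        ∎)
  where
  open ≤-Reasoning
  regroup : ∀ w e → w + 1 + e * 1 ≡ w + suc e
  regroup = solve-∀

module Bounds (n K e₀ : ℕ) (3≤n : 3 ≤ n) (K-small : K + 3 * 2 ^ e₀ ≤ suc e₀ * n) where

  -- A side of G cutting off an arc of L edges of C, where w is the total length of the chords
  -- on that side, the side itself included.
  Bound : ℕ → ℕ → Set
  Bound L w = (2 * L ≤ n → ShortBound L w) × (n < 2 * L → LongBound K (n ∸ L) w)

  bound-edge : ∀ w → Bound 1 w
  bound-edge w = (λ _ → shortBound-edge w) , (λ n<2 → ⊥-elim (<⇒≱ n<2 (≤-trans (s≤s (s≤s z≤n)) 3≤n)))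

  bound-join : ∀ {a b wa wb w} → a + b ≤ n → Bound a wa → Bound b wb →
    wa + wb + cyclicLength n (a + b) ≤ w → Bound (a + b) w
  bound-join {a} {b} {wa} {wb} {w} a+b≤n Ba Bb ≤w = short , long
    where
    short : 2 * (a + b) ≤ n → ShortBound (a + b) w
    short s = shortBound-mono (subst (λ x → wa + wb + x ≤ w) (cyclicLength-short s) ≤w)
      (shortBound-join (proj₁ Ba (≤-trans (*-monoʳ-≤ 2 (m≤m+n a b)) s))
                       (proj₁ Bb (≤-trans (*-monoʳ-≤ 2 (m≤n+m b a)) s)))

    c = n ∸ (a + b)

    triangle : Dec (2 * a ≤ n) → Dec (2 * b ≤ n) → LongBound K c (wa + wb + c)
    triangle (yes sa) (yes sb) = longBound-central e₀ (proj₁ Ba sa) (proj₁ Bb sb)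
      (subst (λ x → K + 3 * 2 ^ e₀ ≤ suc e₀ * x) (sym (m+[n∸m]≡n a+b≤n)) K-small)
    triangle (no la) (yes sb) =
      longBound-join (subst (λ x → LongBound K x wa) (n∸a≡b+[n∸[a+b]] a b a+b≤n) (proj₂ Ba (≰⇒> la))) (proj₁ Bb sb)
    triangle (yes sa) (no lb) = subst (λ x → LongBound K c (x + c)) (+-comm wb wa)
      (longBound-join (subst (λ x → LongBound K x wb) n∸b≡a+c (proj₂ Bb (≰⇒> lb))) (proj₁ Ba sa))
      where
      n∸b≡a+c : n ∸ b ≡ a + c
      n∸b≡a+c = trans (n∸a≡b+[n∸[a+b]] b a (subst (_≤ n) (+-comm a b) a+b≤n)) (cong (λ x → a + (n ∸ x)) (+-comm b a))
    triangle (no la) (no lb) = ⊥-elim (<⇒≱ (+-mono-< (≰⇒> la) (≰⇒> lb)) (begin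
      2 * a + 2 * b   ≡⟨ *-distribˡ-+ 2 a b ⟨
      2 * (a + b)     ≤⟨ *-monoʳ-≤ 2 a+b≤n ⟩
      2 * n           ≡⟨ cong (n +_) (+-identityʳ n) ⟩
      n + n           ∎))
      where open ≤-Reasoning

    long : n < 2 * (a + b) → LongBound K c w
    long l = longBound-mono (subst (λ x → wa + wb + x ≤ w) (cyclicLength-long l) ≤w)
      (triangle (2 * a ≤? n) (2 * b ≤? n))

  bound-root : ∀ {a b wa wb} → suc (a + b) ≡ n → Bound a wa → Bound b wb → K ≤ wa + wb
  bound-root {a} {b} {wa} {wb} refl Ba Bb =
    longBound-edge (subst (λ x → LongBound K x (wa + wb + 1)) (m+n∸n≡m 1 (a + b))
      (proj₂ (bound-join (n≤1+n (a + b)) Ba Bb (≤-reflexive (cong (wa + wb +_) length≡1))) long))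
    where
    long : suc (a + b) < 2 * (a + b)
    long = subst (suc (suc (a + b)) ≤_) (cong ((a + b) +_) (sym (+-identityʳ (a + b))))
             (+-monoˡ-≤ (a + b) (s≤s⁻¹ 3≤n))
    length≡1 : cyclicLength (suc (a + b)) (a + b) ≡ 1
    length≡1 = trans (cyclicLength-long long) (m+n∸n≡m 1 (a + b))

-- Geometry of a maximal outerplanar graph

lastBelow : ∀ {P : ℕ → Set} → Decidable P → ∀ {a j} → a < j → P a →
  ∃[ m ] a ≤ m × m < j × P m × (∀ {m′} → m < m′ → m′ < j → ¬ P m′)
lastBelow {P} P? {a} {suc j} a<1+j Pa with P? j
... | yes Pj = j , s≤s⁻¹ a<1+j , ≤-refl , Pj , λ j<m′ m′<1+j _ → <⇒≱ j<m′ (s≤s⁻¹ m′<1+j)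
... | no ¬Pj with lastBelow P? (≤∧≢⇒< (s≤s⁻¹ a<1+j) (λ { refl → ¬Pj Pa })) Pa
...   | m , a≤m , m<j , Pm , last = m , a≤m , m<n⇒m<1+n m<j , Pm , last′
  where
  last′ : ∀ {m′} → m < m′ → m′ < suc j → ¬ P m′
  last′ {m′} m<m′ m′<1+j with m′ ≟ j
  ... | yes refl = ¬Pj
  ... | no m′≢j  = last m<m′ (≤∧≢⇒< (s≤s⁻¹ m′<1+j) m′≢j)

isChord-span : ∀ {n i j} → IsChord n (i , j) → 2 + i ≤ j
isChord-span (i<j , _ , 2≤j∸i , _) = m≤o∸n⇒m+n≤o 2 (<⇒≤ i<j) 2≤j∸i

_≟ₚ_ : (c d : ℕ × ℕ) → Dec (c ≡ d)
_≟ₚ_ = ≡-dec _≟_ _≟_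

open import Data.List.Membership.DecPropositional _≟ₚ_ using (_∈?_)

Within : ℕ → ℕ → ℕ × ℕ → Set
Within i j (a , b) = i ≤ a × b ≤ j

within? : ∀ i j → Decidable (Within i j)
within? i j (a , b) = (i ≤? a) ×-dec (b ≤? j)

cross-irrefl : ∀ {c} → ¬ Cross c c
cross-irrefl (inj₁ (a<a , _)) = <-irrefl refl a<a
cross-irrefl (inj₂ (a<a , _)) = <-irrefl refl a<a

cross-sym : ∀ {c d} → Cross c d → Cross d c
cross-sym (inj₁ x) = inj₂ x
cross-sym (inj₂ x) = inj₁ x

noncrossing-∈ : ∀ {xs x y} → AllPairs (λ c d → ¬ Cross c d) xs → x ∈ xs → y ∈ xs → ¬ Cross x y
noncrossing-∈ (_ ∷ _)    (here refl) (here refl) = cross-irrefl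
noncrossing-∈ (px ∷ _)   (here refl) (there y∈)  = All.lookup px y∈
noncrossing-∈ (px ∷ _)   (there x∈)  (here refl) = All.lookup px x∈ ∘ cross-sym
noncrossing-∈ (_ ∷ pxs)  (there x∈)  (there y∈)  = noncrossing-∈ pxs x∈ y∈

select : {P : Set} → Dec P → ℕ → ℕ
select (yes _) x = x
select (no _)  x = 0

select-≤ : ∀ {P : Set} (d : Dec P) x → select d x ≤ x
select-≤ (yes _) x = ≤-refl
select-≤ (no _)  x = z≤n

select-split : ∀ {i m j} (c : ℕ × ℕ) x → proj₁ c < proj₂ c → i < m → m < j →
  select (within? i m c) x + select (within? m j c) x + select (c ≟ₚ (i , j)) x ≤ select (within? i j c) x
select-split {i} {m} {j} (a , b) x a<b i<m m<j
  with within? i m (a , b) | within? m j (a , b) | (a , b) ≟ₚ (i , j) | within? i j (a , b)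
... | yes (_ , b≤m) | yes (m≤a , _) | _        | _ = ⊥-elim (<⇒≱ a<b (≤-trans b≤m m≤a))
... | yes (_ , j≤m) | no _          | yes refl | _ = ⊥-elim (<⇒≱ m<j j≤m)
... | yes _         | no _          | no _     | yes _ = ≤-reflexive (trans (+-identityʳ _) (+-identityʳ x))
... | yes (i≤a , b≤m) | no _        | no _     | no ∉ = ⊥-elim (∉ (i≤a , ≤-trans b≤m (<⇒≤ m<j)))
... | no _          | yes (m≤i , _) | yes refl | _ = ⊥-elim (<⇒≱ i<m m≤i)
... | no _          | yes _         | no _     | yes _ = ≤-reflexive (+-identityʳ x)
... | no _          | yes (m≤a , b≤j) | no _   | no ∉ = ⊥-elim (∉ (≤-trans (<⇒≤ i<m) m≤a , b≤j))
... | no _          | no _          | yes refl | yes _ = ≤-refl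
... | no _          | no _          | yes refl | no ∉ = ⊥-elim (∉ (≤-refl , ≤-refl))
... | no _          | no _          | no _     | _ = z≤n

module Triangulated {n : ℕ} (G : MOP n) where

  Adjacent : ℕ → ℕ → Set
  Adjacent i j = j ≡ suc i ⊎ (i , j) ∈ chords G

  adjacent? : ∀ i j → Dec (Adjacent i j)
  adjacent? i j = (j ≟ suc i) ⊎-dec ((i , j) ∈? chords G)

  Uncrossed : ℕ → ℕ → Set
  Uncrossed i j = ∀ {c} → c ∈ chords G → ¬ Cross (i , j) c

  adjacent-uncrossed : ∀ {i j} → Adjacent i j → Uncrossed i j
  adjacent-uncrossed (inj₁ refl) _ (inj₁ (i<c , c<1+i , _)) = <⇒≱ i<c (s≤s⁻¹ c<1+i)
  adjacent-uncrossed (inj₁ refl) _ (inj₂ (_ , i<e , e<1+i)) = <⇒≱ i<e (s≤s⁻¹ e<1+i)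
  adjacent-uncrossed (inj₂ ij∈)  = noncrossing-∈ (noncross G) ij∈

  closing-uncrossed : ∀ {N} → suc N ≡ n → Uncrossed 0 N
  closing-uncrossed refl ce∈ (inj₁ (_ , _ , N<e)) = <⇒≱ N<e (s≤s⁻¹ (proj₁ (proj₂ (All.lookup (valid G) ce∈))))

  -- m is the last neighbour of i before j: a chord crossing (m, j) would cross (i, j) or (i, m),
  -- or be a later neighbour of i.
  apex : ∀ {i j} → 2 + i ≤ j → j < n → Uncrossed i j →
    ∃[ m ] i < m × m < j × Adjacent i m × Adjacent m j
  apex {i} {j} 2+i≤j j<n ij-uncrossed with lastBelow (adjacent? i) 2+i≤j (inj₁ refl)
  ... | m , i<m , m<j , im-adjacent , last = m , i<m , m<j , im-adjacent , mj-adjacent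
    where
    mj-adjacent : Adjacent m j
    mj-adjacent with adjacent? m j
    ... | yes adjacent = adjacent
    ... | no ¬adjacent = ⊥-elim (crossing (find (maximal G (m , j) mj-chord (¬adjacent ∘ inj₂))))
      where
      mj-chord : IsChord n (m , j)
      mj-chord = m<j , j<n , m+n≤o⇒m≤o∸n 2 (≤∧≢⇒< m<j (¬adjacent ∘ inj₁ ∘ sym)) ,
                 λ (m≡0 , _) → <⇒≢ (≤-<-trans z≤n i<m) (sym m≡0)
      crossing : ∃[ c ] c ∈ chords G × Cross (m , j) c → ⊥
      crossing ((c , e) , ce∈ , inj₁ (m<c , c<j , j<e)) = ij-uncrossed ce∈ (inj₁ (<-trans i<m m<c , c<j , j<e))
      crossing ((c , e) , ce∈ , inj₂ (c<m , m<e , e<j)) with <-cmp c i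
      ... | tri< c<i _ _ = ij-uncrossed ce∈ (inj₂ (c<i , <-trans i<m m<e , e<j))
      ... | tri≈ _ refl _ = last m<e e<j (inj₂ ce∈)
      ... | tri> _ _ i<c = adjacent-uncrossed im-adjacent ce∈ (inj₁ (i<c , c<m , m<e))

  lengthOf : {P : ℕ × ℕ → Set} → Decidable P → ℕ
  lengthOf P? = sum (map (λ c → select (P? c) (chordLength n c)) (chords G))

  totalLength : ℕ
  totalLength = sum (map (chordLength n) (chords G))

  lengthOf-≤-total : {P : ℕ × ℕ → Set} (P? : Decidable P) → lengthOf P? ≤ totalLength
  lengthOf-≤-total P? = sum-map-mono-≤ (chords G) (λ {c} _ → select-≤ (P? c) (chordLength n c))

  chordLength-≤-lengthOf : ∀ {P : ℕ × ℕ → Set} (P? : Decidable P) {c} → c ∈ chords G → P c →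
    chordLength n c ≤ lengthOf P?
  chordLength-≤-lengthOf P? {c} c∈ Pc with P? c | ≤-sum-map (λ c → select (P? c) (chordLength n c)) c∈
  ... | yes _ | ≤sum = ≤sum
  ... | no ¬Pc | _   = ⊥-elim (¬Pc Pc)

  lengthOf-split : ∀ {i m j} → i < m → m < j →
    lengthOf (within? i m) + lengthOf (within? m j) + lengthOf (_≟ₚ (i , j)) ≤ lengthOf (within? i j)
  lengthOf-split {i} {m} {j} i<m m<j = begin
    lengthOf (within? i m) + lengthOf (within? m j) + lengthOf (_≟ₚ (i , j))
      ≡⟨ cong (_+ lengthOf (_≟ₚ (i , j))) (sym (sum-map-+ (piece (within? i m)) (piece (within? m j)) (chords G))) ⟩
    sum (map (λ c → piece (within? i m) c + piece (within? m j) c) (chords G)) + lengthOf (_≟ₚ (i , j))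
      ≡⟨ sym (sum-map-+ _ (piece (_≟ₚ (i , j))) (chords G)) ⟩
    sum (map (λ c → piece (within? i m) c + piece (within? m j) c + piece (_≟ₚ (i , j)) c) (chords G))
      ≤⟨ sum-map-mono-≤ (chords G) (λ {c} c∈ →
           select-split c (chordLength n c) (proj₁ (All.lookup (valid G) c∈)) i<m m<j) ⟩
    lengthOf (within? i j) ∎
    where
    open ≤-Reasoning
    piece : {P : ℕ × ℕ → Set} → Decidable P → ℕ × ℕ → ℕ
    piece P? c = select (P? c) (chordLength n c)

  module _ {K e₀} (3≤n : 3 ≤ n) (K-small : K + 3 * 2 ^ e₀ ≤ suc e₀ * n) where
    open Bounds n K e₀ 3≤n K-small

    bound-triangle : ∀ {i m j wa wb w} → i < m → m < j → j < n →
      Bound (m ∸ i) wa → Bound (j ∸ m) wb → wa + wb + chordLength n (i , j) ≤ w → Bound (j ∸ i) w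
    bound-triangle {i} {m} {j} {wa} {wb} {w} i<m m<j j<n Ba Bb ≤w =
      subst (λ L → Bound L w) sides (bound-join (subst (_≤ n) (sym sides) (≤-trans (m∸n≤m j i) (<⇒≤ j<n))) Ba Bb
        (subst (λ L → wa + wb + cyclicLength n L ≤ w) (sym sides) ≤w))
      where
      sides : (m ∸ i) + (j ∸ m) ≡ j ∸ i
      sides = [m∸i]+[j∸m]≡j∸i (<⇒≤ i<m) (<⇒≤ m<j)

    bound-adjacent : ∀ {i j} → Acc _<_ (j ∸ i) → j < n → Adjacent i j → Bound (j ∸ i) (lengthOf (within? i j))
    bound-adjacent {i} _ _ (inj₁ refl) =
      subst (λ L → Bound L (lengthOf (within? i (suc i)))) (sym (m+n∸n≡m 1 i)) (bound-edge _)
    bound-adjacent {i} {j} (acc rec) j<n (inj₂ ij∈)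
      with apex (isChord-span (All.lookup (valid G) ij∈)) j<n (adjacent-uncrossed (inj₂ ij∈))
    ... | m , i<m , m<j , im-adjacent , mj-adjacent = bound-triangle i<m m<j j<n
      (bound-adjacent (rec (∸-monoˡ-< m<j (<⇒≤ i<m))) (<-trans m<j j<n) im-adjacent)
      (bound-adjacent (rec (∸-monoʳ-< i<m (<⇒≤ m<j))) j<n mj-adjacent)
      (≤-trans (+-monoʳ-≤ _ (chordLength-≤-lengthOf (_≟ₚ (i , j)) ij∈ refl)) (lengthOf-split i<m m<j))

    private
      N : ℕ
      N = n ∸ 1
      1+N≡n : suc N ≡ n
      1+N≡n = m+[n∸m]≡n (≤-trans (s≤s z≤n) 3≤n)
      N<n : N < n
      N<n = subst (N <_) 1+N≡n ≤-refl
      2≤N : 2 ≤ N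
      2≤N = m+n≤o⇒m≤o∸n 2 3≤n

    totalLength-≥ : K ≤ totalLength
    totalLength-≥ with apex 2≤N N<n (closing-uncrossed 1+N≡n)
    ... | m , 0<m , m<N , 0m-adjacent , mN-adjacent = begin
      K
        ≤⟨ bound-root sides (bound-adjacent (<-wellFounded m) (<-trans m<N N<n) 0m-adjacent)
                            (bound-adjacent (<-wellFounded (N ∸ m)) N<n mN-adjacent) ⟩
      lengthOf (within? 0 m) + lengthOf (within? m N)
        ≤⟨ m≤m+n _ _ ⟩
      lengthOf (within? 0 m) + lengthOf (within? m N) + lengthOf (_≟ₚ (0 , N))
        ≤⟨ lengthOf-split 0<m m<N ⟩
      lengthOf (within? 0 N)
        ≤⟨ lengthOf-≤-total (within? 0 N) ⟩
      totalLength
        ∎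
      where
      open ≤-Reasoning
      sides : suc (m + (N ∸ m)) ≡ n
      sides = trans (cong suc (m+[n∸m]≡n (<⇒≤ m<N))) 1+N≡n

  sumFrom-nG2 : sumFrom (nG2 G) 0 n ≡ 2 * totalLength
  sumFrom-nG2 = begin
    sumFrom (nG2 G) 0 n                                        ≡⟨ sumFrom-sum-comm (weight n) (chords G) 0 n ⟩
    sum (map (λ c → sumFrom (λ t → weight n t c) 0 n) (chords G)) ≡⟨ sum-map-cong (chords G) chord-count ⟩
    sum (map (λ c → 2 * chordLength n c) (chords G))           ≡⟨ sum-map-*ˡ (chordLength n) 2 (chords G) ⟩
    2 * totalLength                                            ∎
    where
    open ≡-Reasoning
    chord-count : ∀ {c} → c ∈ chords G → sumFrom (λ t → weight n t c) 0 n ≡ 2 * chordLength n c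
    chord-count {a , b} c∈ with All.lookup (valid G) c∈
    ... | a<b , b<n , _ = sumFrom-weight (<⇒≤ a<b) (<⇒≤ b<n)

  totalLength-≤ : ∀ {k} → Bounded G k → totalLength ≤ k * n
  totalLength-≤ {k} bounded = *-cancelˡ-≤ 2 (begin
    2 * totalLength          ≡⟨ sumFrom-nG2 ⟨
    sumFrom (nG2 G) 0 n      ≤⟨ sumFrom-mono-≤ 0 n (λ _ t<n → bounded _ t<n) ⟩
    sumFrom (λ _ → 2 * k) 0 n ≡⟨ sumFrom-const (2 * k) 0 n ⟩
    n * (2 * k)              ≡⟨ swap n k ⟩
    2 * (k * n)              ∎)
    where
    open ≤-Reasoning
    swap : ∀ n k → n * (2 * k) ≡ 2 * (k * n)
    swap = solve-∀

order-bounded : ∀ {n k} → 3 ≤ n → (G : MOP n) → Bounded G k → n ≤ 3 * 2 ^ k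
order-bounded {n} {k} 3≤n G bounded with n ≤? 3 * 2 ^ k
... | yes n≤ = n≤
... | no n≰  = ⊥-elim (<-irrefl refl (≤-trans (totalLength-≥ {e₀ = k} 3≤n K-small) (totalLength-≤ {k} bounded)))
  where
  open Triangulated G
  K-small : suc (k * n) + 3 * 2 ^ k ≤ suc k * n
  K-small = begin
    suc (k * n) + 3 * 2 ^ k   ≡⟨ +-comm (suc (k * n)) _ ⟩
    3 * 2 ^ k + suc (k * n)   ≡⟨ +-suc (3 * 2 ^ k) (k * n) ⟩
    suc (3 * 2 ^ k) + k * n   ≤⟨ +-monoˡ-≤ (k * n) (≰⇒> n≰) ⟩
    n + k * n                 ∎
    where open ≤-Reasoning

-- Triangulations given by binary trees

data Tree : Set where
  leaf : Tree
  node : ℕ → Tree → Tree → Tree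

-- node m l r is the triangle (i, m, j) of a triangulation of the polygon i, i+1, …, j.
Triangulates : ℕ → ℕ → Tree → Set
Triangulates i j leaf         = j ≡ suc i
Triangulates i j (node m l r) = Triangulates i m l × Triangulates m j r

mutual
  diagonals⁺ : ℕ → ℕ → Tree → List (ℕ × ℕ)
  diagonals⁺ i j leaf           = []
  diagonals⁺ i j T@(node _ _ _) = (i , j) ∷ diagonals i j T

  diagonals : ℕ → ℕ → Tree → List (ℕ × ℕ)
  diagonals i j leaf         = []
  diagonals i j (node m l r) = diagonals⁺ i m l ++ diagonals⁺ m j r

Diagonal : ℕ → ℕ → ℕ × ℕ → Set
Diagonal i j (a , b) = i ≤ a × b ≤ j × 2 + a ≤ b

ProperDiagonal : ℕ → ℕ → ℕ × ℕ → Set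
ProperDiagonal i j (a , b) = Diagonal i j (a , b) × (b < j ⊎ i < a)

triangulates-< : ∀ {i j} T → Triangulates i j T → i < j
triangulates-< leaf         refl       = ≤-refl
triangulates-< (node m l r) (tl , tr) = <-trans (triangulates-< l tl) (triangulates-< r tr)

base-∈ : ∀ {i j} T → Triangulates i j T → 2 + i ≤ j → (i , j) ∈ diagonals⁺ i j T
base-∈ leaf         refl 2+i≤1+i = ⊥-elim (<-irrefl refl 2+i≤1+i)
base-∈ (node _ _ _) _    _       = here refl

diagonals-⊆ : ∀ {P : ℕ × ℕ → Set} {i j} T → Any P (diagonals i j T) → Any P (diagonals⁺ i j T)
diagonals-⊆ (node _ _ _) p = there p

mutual
  diagonals⁺-diagonal : ∀ {i j} T → Triangulates i j T → All (Diagonal i j) (diagonals⁺ i j T)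
  diagonals⁺-diagonal leaf _ = []
  diagonals⁺-diagonal T@(node m l r) t =
    (≤-refl , ≤-refl , ≤-trans (s≤s (triangulates-< l (proj₁ t))) (triangulates-< r (proj₂ t)))
    ∷ All.map proj₁ (diagonals-proper T t)

  diagonals-proper : ∀ {i j} T → Triangulates i j T → All (ProperDiagonal i j) (diagonals i j T)
  diagonals-proper leaf _ = []
  diagonals-proper {i} {j} (node m l r) (tl , tr) =
    All-++⁺ (All.map left-proper (diagonals⁺-diagonal l tl)) (All.map right-proper (diagonals⁺-diagonal r tr))
    where
    i<m = triangulates-< l tl
    m<j = triangulates-< r tr
    left-proper : ∀ {c} → Diagonal i m c → ProperDiagonal i j c
    left-proper (i≤a , b≤m , 2+a≤b) = (i≤a , ≤-trans b≤m (<⇒≤ m<j) , 2+a≤b) , inj₁ (≤-<-trans b≤m m<j)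
    right-proper : ∀ {c} → Diagonal m j c → ProperDiagonal i j c
    right-proper (m≤a , b≤j , 2+a≤b) = (≤-trans (<⇒≤ i<m) m≤a , b≤j , 2+a≤b) , inj₂ (<-≤-trans i<m m≤a)

module _ (R : ℕ × ℕ → ℕ × ℕ → Set)
         (R-sides : ∀ {i m j x y} → Diagonal i m x → Diagonal m j y → R x y)
         (R-base : ∀ {i j y} → ProperDiagonal i j y → R (i , j) y) where

  mutual
    allPairs-diagonals⁺ : ∀ {i j} T → Triangulates i j T → AllPairs R (diagonals⁺ i j T)
    allPairs-diagonals⁺ leaf _ = []
    allPairs-diagonals⁺ T@(node _ _ _) t = All.map R-base (diagonals-proper T t) ∷ allPairs-diagonals T t

    allPairs-diagonals : ∀ {i j} T → Triangulates i j T → AllPairs R (diagonals i j T)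
    allPairs-diagonals leaf _ = []
    allPairs-diagonals (node m l r) (tl , tr) =
      AllPairs-++⁺ (allPairs-diagonals⁺ l tl) (allPairs-diagonals⁺ r tr)
        (All.map (λ dx → All.map (R-sides dx) (diagonals⁺-diagonal r tr)) (diagonals⁺-diagonal l tl))

sides-distinct : ∀ {i m j x y} → Diagonal i m x → Diagonal m j y → x ≢ y
sides-distinct (_ , b≤m , 2+a≤b) (m≤a , _ , _) refl = <⇒≱ 2+a≤b (≤-trans (≤-trans b≤m m≤a) (n≤1+n _))

base-distinct : ∀ {i j y} → ProperDiagonal i j y → (i , j) ≢ y
base-distinct (_ , inj₁ j<j) refl = <-irrefl refl j<j
base-distinct (_ , inj₂ i<i) refl = <-irrefl refl i<i

sides-noncrossing : ∀ {i m j x y} → Diagonal i m x → Diagonal m j y → ¬ Cross x y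
sides-noncrossing (_ , b≤m , _) (m≤c , _ , _) (inj₁ (_ , c<b , _)) = <⇒≱ c<b (≤-trans b≤m m≤c)
sides-noncrossing (_ , b≤m , 2+a≤b) (m≤c , _ , _) (inj₂ (c<a , _ , _)) =
  <⇒≱ (<-trans c<a (≤-trans (n≤1+n _) 2+a≤b)) (≤-trans b≤m m≤c)

base-noncrossing : ∀ {i j y} → ProperDiagonal i j y → ¬ Cross (i , j) y
base-noncrossing ((_ , d≤j , _) , _) (inj₁ (_ , _ , j<d)) = <⇒≱ j<d d≤j
base-noncrossing ((i≤c , _ , _) , _) (inj₂ (c<i , _ , _)) = <⇒≱ c<i i≤c

proper-or-base : ∀ {i j x y} → i ≤ x → y ≤ j → (x , y) ≡ (i , j) ⊎ (y < j ⊎ i < x)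
proper-or-base i≤x y≤j with m≤n⇒m<n∨m≡n y≤j | m≤n⇒m<n∨m≡n i≤x
... | inj₁ y<j  | _         = inj₂ (inj₁ y<j)
... | inj₂ _    | inj₁ i<x  = inj₂ (inj₂ i<x)
... | inj₂ refl | inj₂ refl = inj₁ refl

diagonals-maximal : ∀ {i j} T → Triangulates i j T → ∀ {c} → ProperDiagonal i j c →
  c ∈ diagonals i j T ⊎ Any (Cross c) (diagonals i j T)
diagonals-maximal leaf refl ((i≤x , y≤1+i , 2+x≤y) , _) = ⊥-elim (<⇒≱ (≤-trans (s≤s (s≤s i≤x)) 2+x≤y) y≤1+i)
diagonals-maximal {i} {j} (node m l r) (tl , tr) {x , y} ((i≤x , y≤j , 2+x≤y) , proper) with y ≤? m | m ≤? x
... | yes y≤m | _ with proper-or-base i≤x y≤m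
...   | inj₁ refl    = inj₁ (++⁺ˡ (base-∈ l tl 2+x≤y))
...   | inj₂ proper′ = Sum.map (++⁺ˡ ∘ diagonals-⊆ l) (++⁺ˡ ∘ diagonals-⊆ l)
                               (diagonals-maximal l tl ((i≤x , y≤m , 2+x≤y) , proper′))
diagonals-maximal {i} {j} (node m l r) (tl , tr) {x , y} ((i≤x , y≤j , 2+x≤y) , proper) | no _ | yes m≤x
  with proper-or-base m≤x y≤j
...   | inj₁ refl    = inj₁ (++⁺ʳ (diagonals⁺ i m l) (base-∈ r tr 2+x≤y))
...   | inj₂ proper′ = Sum.map (++⁺ʳ (diagonals⁺ i m l) ∘ diagonals-⊆ r)
                               (++⁺ʳ (diagonals⁺ i m l) ∘ diagonals-⊆ r)
                               (diagonals-maximal r tr ((m≤x , y≤j , 2+x≤y) , proper′))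
diagonals-maximal {i} {j} (node m l r) (tl , tr) {x , y} ((i≤x , y≤j , 2+x≤y) , proper) | no y≰m | no m≰x
  with m≤n⇒m<n∨m≡n i≤x
... | inj₁ i<x  = inj₂ (++⁺ˡ (lose (base-∈ l tl (≤-trans (s≤s i<x) (≰⇒> m≰x)))
                                  (inj₂ (i<x , ≰⇒> m≰x , ≰⇒> y≰m))))
... | inj₂ refl = inj₂ (++⁺ʳ (diagonals⁺ i m l) (lose (base-∈ r tr (≤-trans (s≤s (≰⇒> y≰m)) y<j))
                                                     (inj₁ (≰⇒> m≰x , ≰⇒> y≰m , y<j))))
  where
  y<j : y < j
  y<j = Sum.fromInj₁ (⊥-elim ∘ <-irrefl refl) proper

toMOP : ∀ {n N} T → suc N ≡ n → Triangulates 0 N T → MOP n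
toMOP {n} {N} T 1+N≡n t = record
  { chords   = diagonals 0 N T
  ; valid    = All.map isChord (diagonals-proper T t)
  ; unique   = allPairs-diagonals _≢_ sides-distinct base-distinct T t
  ; noncross = allPairs-diagonals (λ c d → ¬ Cross c d) sides-noncrossing base-noncrossing T t
  ; maximal  = maximal′
  }
  where
  N<n : N < n
  N<n = subst (N <_) 1+N≡n ≤-refl

  isChord : ∀ {c} → ProperDiagonal 0 N c → IsChord n c
  isChord {a , b} ((_ , b≤N , 2+a≤b) , proper) =
    ≤-trans (n≤1+n _) 2+a≤b , ≤-<-trans b≤N N<n , m+n≤o⇒m≤o∸n 2 2+a≤b , not-closing proper
    where
    not-closing : b < N ⊎ 0 < a → ¬ (a ≡ 0 × suc b ≡ n)
    not-closing (inj₁ b<N) (_ , 1+b≡n) = <-irrefl (suc-injective (trans 1+b≡n (sym 1+N≡n))) b<N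
    not-closing (inj₂ 0<a) (a≡0 , _)   = <-irrefl (sym a≡0) 0<a

  maximal′ : ∀ c → IsChord n c → c ∉ diagonals 0 N T → Any (Cross c) (diagonals 0 N T)
  maximal′ (x , y) c@(_ , y<n , _ , not-closing) c∉ with diagonals-maximal T t (proper-diagonal (x ≟ 0))
    where
    y≤N : y ≤ N
    y≤N = s≤s⁻¹ (subst (y <_) (sym 1+N≡n) y<n)
    proper-diagonal : Dec (x ≡ 0) → ProperDiagonal 0 N (x , y)
    proper-diagonal (yes x≡0) = (z≤n , y≤N , isChord-span c) ,
      inj₁ (≤∧≢⇒< y≤N (λ y≡N → not-closing (x≡0 , trans (cong suc y≡N) 1+N≡n)))
    proper-diagonal (no x≢0)  = (z≤n , y≤N , isChord-span c) , inj₂ (n≢0⇒n>0 x≢0)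
  ... | inj₁ c∈      = ⊥-elim (c∉ c∈)
  ... | inj₂ crosses = crosses

-- The extremal graph

block : ℕ → ℕ → Tree
block s zero    = leaf
block s (suc j) = node (s + 2 ^ j) (block s j) (block (s + 2 ^ j) j)

halves : ∀ {s e} j → e ≡ s + 2 ^ suc j → e ≡ (s + 2 ^ j) + 2 ^ j
halves {s} j refl = split s (2 ^ j)
  where
  split : ∀ s p → s + 2 * p ≡ s + p + p
  split = solve-∀

triangulates-block : ∀ j {s e} → e ≡ s + 2 ^ j → Triangulates s e (block s j)
triangulates-block zero    {s} refl = +-comm s 1
triangulates-block (suc j) e≡      = triangulates-block j refl , triangulates-block j (halves j e≡)

module Load (n : ℕ) where

  load : ℕ → List (ℕ × ℕ) → ℕ
  load t cs = sum (map (weight n t) cs)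

  load-++ : ∀ t cs ds → load t (cs ++ ds) ≡ load t cs + load t ds
  load-++ t cs ds = trans (cong sum (map-++ (weight n t) cs ds)) (sum-++ (map (weight n t) cs) _)

  load-node : ∀ t i j m l r →
    load t (diagonals⁺ i j (node m l r)) ≡ weight n t (i , j) + (load t (diagonals⁺ i m l) + load t (diagonals⁺ m j r))
  load-node t i j m l r = cong (weight n t (i , j) +_) (load-++ t (diagonals⁺ i m l) (diagonals⁺ m j r))

  short-half : ∀ j → 2 * 2 ^ suc j < n → 2 * 2 ^ j < n
  short-half j short = ≤-<-trans (*-monoʳ-≤ 2 (m≤m+n (2 ^ j) _)) short

  short-base : ∀ j s → 2 * 2 ^ j < n → 2 * (s + 2 ^ j ∸ s) < n
  short-base j s short = subst (λ L → 2 * L < n) (sym (m+n∸m≡n s _)) short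

  load-block-outside : ∀ j {s e t} → e ≡ s + 2 ^ j → 2 * 2 ^ j < n → t < s ⊎ e ≤ t →
    load t (diagonals⁺ s e (block s j)) ≡ 0
  load-block-outside zero    _    _     _  = refl
  load-block-outside (suc j) {s} {t = t} refl short t∉ = begin
    load t (diagonals⁺ s e (block s (suc j)))              ≡⟨ load-node t s e m (block s j) (block m j) ⟩
    weight n t (s , e) + (load t left + load t right)
      ≡⟨ cong₂ _+_ (weight-short-∉ {a = s} (short-base (suc j) s short) t∉)
                   (cong₂ _+_ (load-block-outside j refl (short-half j short) t∉left)
                              (load-block-outside j (halves j refl) (short-half j short) t∉right)) ⟩
    0                                                      ∎
    where
    open ≡-Reasoning
    m = s + 2 ^ j
    e = s + 2 ^ suc j
    left = diagonals⁺ s m (block s j)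
    right = diagonals⁺ m e (block m j)
    t∉left : t < s ⊎ m ≤ t
    t∉left = Sum.map₂ (≤-trans (≤-trans (m≤m+n m _) (≤-reflexive (sym (halves j refl))))) t∉
    t∉right : t < m ⊎ e ≤ t
    t∉right = Sum.map₁ (λ t<s → <-≤-trans t<s (m≤m+n s _)) t∉

  load-block-inside : ∀ j {s e t} → e ≡ s + 2 ^ j → 2 * 2 ^ j < n → s ≤ t → t < e →
    load t (diagonals⁺ s e (block s j)) ≤ 2 * j
  load-block-inside zero    _    _     _   _   = z≤n
  load-block-inside (suc j) {s} {t = t} refl short s≤t t<e = begin
    load t (diagonals⁺ s e (block s (suc j)))              ≡⟨ load-node t s e m (block s j) (block m j) ⟩
    weight n t (s , e) + (load t left + load t right)
      ≡⟨ cong (_+ (load t left + load t right)) (weight-short-∈ {a = s} (short-base (suc j) s short) s≤t t<e) ⟩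
    2 + (load t left + load t right)                       ≤⟨ +-monoʳ-≤ 2 (halves-load (t <? m)) ⟩
    2 + 2 * j                                              ≡⟨ *-suc 2 j ⟨
    2 * suc j                                              ∎
    where
    open ≤-Reasoning
    m = s + 2 ^ j
    e = s + 2 ^ suc j
    left = diagonals⁺ s m (block s j)
    right = diagonals⁺ m e (block m j)
    halves-load : Dec (t < m) → load t left + load t right ≤ 2 * j
    halves-load (yes t<m) = begin
      load t left + load t right
        ≡⟨ cong (load t left +_) (load-block-outside j (halves j refl) (short-half j short) (inj₁ t<m)) ⟩
      load t left + 0              ≡⟨ +-identityʳ _ ⟩
      load t left                  ≤⟨ load-block-inside j refl (short-half j short) s≤t t<m ⟩
      2 * j                        ∎
    halves-load (no t≮m)  = begin
      load t left + load t right
        ≡⟨ cong (_+ load t right) (load-block-outside j refl (short-half j short) (inj₂ (≮⇒≥ t≮m))) ⟩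
      load t right                 ≤⟨ load-block-inside j (halves j refl) (short-half j short) (≮⇒≥ t≮m) t<e ⟩
      2 * j                        ∎

module Extremal (k : ℕ) where

  Q : ℕ
  Q = 2 ^ k

  n : ℕ
  n = 3 * Q

  open Load n

  0<Q : 0 < Q
  0<Q = m^n>0 2 k

  n∸Q≡Q+Q : n ∸ Q ≡ Q + Q
  n∸Q≡Q+Q = trans (m+n∸m≡n Q (Q + (Q + 0))) (cong (Q +_) (+-identityʳ Q))

  block-short : ∀ {j} → j ≤ k → 2 * 2 ^ j < n
  block-short j≤k = ≤-<-trans (*-monoʳ-≤ 2 (^-monoʳ-≤ 2 j≤k)) (m<n+m (2 * Q) 0<Q)

  fan-chord-long : ∀ {j} → suc j ≤ k → n < 2 * (n ∸ 2 ^ suc j)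
  fan-chord-long 1+j≤k = <-≤-trans (subst (n <_) (3Q+Q≡2[Q+Q] Q) (m<m+n n 0<Q))
    (*-monoʳ-≤ 2 (≤-trans (≤-reflexive (sym n∸Q≡Q+Q)) (∸-monoʳ-≤ n (^-monoʳ-≤ 2 1+j≤k))))
    where
    3Q+Q≡2[Q+Q] : ∀ Q → 3 * Q + Q ≡ 2 * (Q + Q)
    3Q+Q≡2[Q+Q] = solve-∀

  fan-split : ∀ {j} → suc j ≤ k → n ∸ 2 ^ j ≡ (n ∸ 2 ^ suc j) + 2 ^ j
  fan-split {j} 1+j≤k = m∸n≡m∸2n+n {n = 2 ^ j} (≤-trans (^-monoʳ-≤ 2 1+j≤k) (m≤m+n Q _))

  -- Seen from the closing edge (n−1, 0), the third block [2Q, 3Q] hangs off vertex 0 as a fan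
  -- of long chords (0, n − 2^(j+1)), each followed by a block of 2^j edges.
  fan : ℕ → ℕ → Tree
  fan j zero    = node Q (block 0 k) (block Q k)
  fan j (suc d) = node (n ∸ 2 ^ suc j) (fan (suc j) d) (block (n ∸ 2 ^ suc j) j)

  diagonals⁺-fan : ∀ j d X → diagonals⁺ 0 X (fan j d) ≡ (0 , X) ∷ diagonals 0 X (fan j d)
  diagonals⁺-fan j zero    X = refl
  diagonals⁺-fan j (suc d) X = refl

  module _ {j d : ℕ} (j+1+d≡k : j + suc d ≡ k) where
    1+j+d≡k : suc j + d ≡ k
    1+j+d≡k = trans (sym (+-suc j d)) j+1+d≡k

    1+j≤k : suc j ≤ k
    1+j≤k = ≤-trans (s≤s (m≤m+n j d)) (≤-reflexive 1+j+d≡k)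

  last-fan : ∀ {j} → j + 0 ≡ k → n ∸ 2 ^ j ≡ Q + Q
  last-fan {j} j+0≡k = trans (cong (λ x → n ∸ 2 ^ x) (trans (sym (+-identityʳ j)) j+0≡k)) n∸Q≡Q+Q

  triangulates-fan : ∀ j d → j + d ≡ k → Triangulates 0 (n ∸ 2 ^ j) (fan j d)
  triangulates-fan j zero    j+0≡k   = triangulates-block k refl , triangulates-block k (last-fan j+0≡k)
  triangulates-fan j (suc d) j+1+d≡k =
    triangulates-fan (suc j) d (1+j+d≡k j+1+d≡k) , triangulates-block j (fan-split (1+j≤k j+1+d≡k))

  load-fan-node : ∀ j d t → load t (diagonals 0 (n ∸ 2 ^ j) (fan j (suc d))) ≡
    weight n t (0 , n ∸ 2 ^ suc j) + load t (diagonals 0 (n ∸ 2 ^ suc j) (fan (suc j) d))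
      + load t (diagonals⁺ (n ∸ 2 ^ suc j) (n ∸ 2 ^ j) (block (n ∸ 2 ^ suc j) j))
  load-fan-node j d t = trans (load-++ t (diagonals⁺ 0 X (fan (suc j) d)) _)
                              (cong (λ cs → load t cs + _) (diagonals⁺-fan (suc j) d X))
    where X = n ∸ 2 ^ suc j

  load-fan-right : ∀ j d {t} → j + d ≡ k → n ∸ 2 ^ j ≤ t → load t (diagonals 0 (n ∸ 2 ^ j) (fan j d)) ≤ 2 * d
  load-fan-right j zero {t} j+0≡k E≤t = ≤-reflexive (begin
    load t (diagonals⁺ 0 Q (block 0 k) ++ diagonals⁺ Q (n ∸ 2 ^ j) (block Q k))
      ≡⟨ load-++ t (diagonals⁺ 0 Q (block 0 k)) _ ⟩
    load t (diagonals⁺ 0 Q (block 0 k)) + load t (diagonals⁺ Q (n ∸ 2 ^ j) (block Q k))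
      ≡⟨ cong₂ _+_ (load-block-outside k refl (block-short ≤-refl) (inj₂ Q≤t))
                   (load-block-outside k (last-fan j+0≡k) (block-short ≤-refl) (inj₂ E≤t)) ⟩
    0 ∎)
    where
    open ≡-Reasoning
    Q≤t : Q ≤ t
    Q≤t = ≤-trans (≤-trans (m≤m+n Q Q) (≤-reflexive (sym (last-fan j+0≡k)))) E≤t
  load-fan-right j (suc d) {t} j+1+d≡k E≤t = begin
    load t (diagonals 0 E (fan j (suc d)))          ≡⟨ load-fan-node j d t ⟩
    weight n t (0 , X) + spine + side
      ≡⟨ cong₂ (λ w b → w + spine + b) (weight-long-∉ {a = 0} (fan-chord-long 1+j≤k′) (inj₂ X≤t))
                                      (load-block-outside j (fan-split 1+j≤k′) (block-short (<⇒≤ 1+j≤k′)) (inj₂ E≤t)) ⟩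
    2 + spine + 0
      ≤⟨ +-monoˡ-≤ 0 (+-monoʳ-≤ 2 (load-fan-right (suc j) d (1+j+d≡k j+1+d≡k) X≤t)) ⟩
    2 + 2 * d + 0                                   ≡⟨ double-suc d ⟩
    2 * suc d                                       ∎
    where
    open ≤-Reasoning
    X = n ∸ 2 ^ suc j
    E = n ∸ 2 ^ j
    spine = load t (diagonals 0 X (fan (suc j) d))
    side = load t (diagonals⁺ X E (block X j))
    1+j≤k′ = 1+j≤k j+1+d≡k
    X≤t : X ≤ t
    X≤t = ≤-trans (≤-trans (m≤m+n X _) (≤-reflexive (sym (fan-split 1+j≤k′)))) E≤t
    double-suc : ∀ d → 2 + 2 * d + 0 ≡ 2 * suc d
    double-suc = solve-∀

  load-fan-left : ∀ j d {t} → j + d ≡ k → t < n ∸ 2 ^ j → load t (diagonals 0 (n ∸ 2 ^ j) (fan j d)) ≤ 2 * k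
  load-fan-left j zero {t} j+0≡k t<E = begin
    load t (diagonals⁺ 0 Q (block 0 k) ++ diagonals⁺ Q (n ∸ 2 ^ j) (block Q k))
      ≡⟨ load-++ t (diagonals⁺ 0 Q (block 0 k)) _ ⟩
    load t (diagonals⁺ 0 Q (block 0 k)) + load t (diagonals⁺ Q (n ∸ 2 ^ j) (block Q k))
      ≤⟨ one-block (t <? Q) ⟩
    2 * k ∎
    where
    open ≤-Reasoning
    one-block : Dec (t < Q) →
      load t (diagonals⁺ 0 Q (block 0 k)) + load t (diagonals⁺ Q (n ∸ 2 ^ j) (block Q k)) ≤ 2 * k
    one-block (yes t<Q) =
      ≤-trans (+-mono-≤ (load-block-inside k refl (block-short ≤-refl) z≤n t<Q)
                        (≤-reflexive (load-block-outside k (last-fan j+0≡k) (block-short ≤-refl) (inj₁ t<Q))))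
              (≤-reflexive (+-identityʳ (2 * k)))
    one-block (no t≮Q)  =
      +-mono-≤ (≤-reflexive (load-block-outside k refl (block-short ≤-refl) (inj₂ (≮⇒≥ t≮Q))))
               (load-block-inside k (last-fan j+0≡k) (block-short ≤-refl) (≮⇒≥ t≮Q) t<E)
  load-fan-left j (suc d) {t} j+1+d≡k t<E = begin
    load t (diagonals 0 E (fan j (suc d)))          ≡⟨ load-fan-node j d t ⟩
    weight n t (0 , X) + spine + side               ≤⟨ split (t <? X) ⟩
    2 * k                                           ∎
    where
    open ≤-Reasoning
    X = n ∸ 2 ^ suc j
    E = n ∸ 2 ^ j
    spine = load t (diagonals 0 X (fan (suc j) d))
    side = load t (diagonals⁺ X E (block X j))
    1+j≤k′ = 1+j≤k j+1+d≡k
    split : Dec (t < X) → weight n t (0 , X) + spine + side ≤ 2 * k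
    split (yes t<X) = begin
      weight n t (0 , X) + spine + side
        ≡⟨ cong₂ (λ w b → w + spine + b) (weight-long-∈ {a = 0} (fan-chord-long 1+j≤k′) z≤n t<X)
                                        (load-block-outside j (fan-split 1+j≤k′) (block-short (<⇒≤ 1+j≤k′)) (inj₁ t<X)) ⟩
      spine + 0                                     ≤⟨ +-monoˡ-≤ 0 (load-fan-left (suc j) d (1+j+d≡k j+1+d≡k) t<X) ⟩
      2 * k + 0                                     ≡⟨ +-identityʳ (2 * k) ⟩
      2 * k                                         ∎
    split (no t≮X) = begin
      weight n t (0 , X) + spine + side
        ≡⟨ cong (λ w → w + spine + side) (weight-long-∉ {a = 0} (fan-chord-long 1+j≤k′) (inj₂ (≮⇒≥ t≮X))) ⟩
      2 + spine + side
        ≤⟨ +-mono-≤ (+-monoʳ-≤ 2 (load-fan-right (suc j) d (1+j+d≡k j+1+d≡k) (≮⇒≥ t≮X)))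
                    (load-block-inside j (fan-split 1+j≤k′) (block-short (<⇒≤ 1+j≤k′)) (≮⇒≥ t≮X) t<E) ⟩
      2 + 2 * d + 2 * j                             ≡⟨ count j d ⟩
      2 * (j + suc d)                               ≡⟨ cong (2 *_) j+1+d≡k ⟩
      2 * k                                         ∎
      where
      count : ∀ j d → 2 + 2 * d + 2 * j ≡ 2 * (j + suc d)
      count = solve-∀

  extremal : MOP n
  extremal = toMOP (fan 0 k) (m+[n∸m]≡n (≤-trans 0<Q (m≤m+n Q _))) (triangulates-fan 0 k refl)

  extremal-bounded : Bounded extremal k
  extremal-bounded t _ with t <? n ∸ 1
  ... | yes t<n∸1 = load-fan-left 0 k refl t<n∸1
  ... | no t≮n∸1  = load-fan-right 0 k refl (≮⇒≥ t≮n∸1)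

theorem4 : ∀ (k : ℕ) → 1 ≤ k →
    (Σ (MOP (3 * 2 ^ k)) (λ G → Bounded G k))
    × (∀ (n : ℕ) → 3 ≤ n → (G : MOP n) → Bounded G k → n ≤ 3 * 2 ^ k)
theorem4 k _ = (Extremal.extremal k , Extremal.extremal-bounded k) , λ n 3≤n G → order-bounded {k = k} 3≤n G
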